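{- For every instance of the free-block server placement problem described in the context, $$\mathrm{OPT}\ \ge\ \frac{1}{k}\sum_{j=1}^n \alpha_j\cdot \frac{d_j}{\widehat f_j(\alpha_j)}.$$
   Context: Instance: positive integer $k$ (processors per machine) and $n$ jobs; job $j$ has a positive integer demand $d_j$ and a vector $(f_j(1),\dots,f_j(k))$ of integers with $f_j(i)\ge 1$ for all $i$ ($f_j$ need not be monotone), where $f_j(i)$ is the demand satisfied by a block of $i$ processors. A solution uses some number of machines; the $k$ processors of each machine are partitioned into blocks of arbitrary sizes, each block assigned to at most one job; it is feasible if for each job $j$ the sum of $f_j(i)$ over the blocks (of size $i$) assigned to $j$ is at least $d_j$. $\mathrm{OPT}$ is the minimum number of machines of a feasible solution. Define $\widehat f_j(i)=\min\{f_j(i),d_j\}$ and let $\alpha_j$ be the smallest $i\in\{1,\dots,k\}$ maximizing $\widehat f_j(i)/i$. -}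

module Defs where

open import Data.Nat as ℕ using (ℕ; zero; suc; _⊓_; NonZero; >-nonZero)
open import Data.Nat.Properties using (⊓-glb)
open import Data.Fin using (Fin; toℕ)
open import Data.Maybe using (Maybe; just; nothing)
open import Data.List using (List; []; _∷_; map)
open import Data.Nat.ListAction using (sum)
open import Data.Vec using (Vec)
import Data.Vec as V
open import Data.Product using (_×_; _,_; proj₁; proj₂; Σ; ∃)
open import Relation.Binary.PropositionalEquality using (_≡_)
open import Relation.Nullary using (yes; no)
open import Data.Fin using (_≟_)
open import Data.Integer using (+_)
open import Data.Rational as ℚ using (ℚ; 0ℚ; _/_)

-- An instance of the free-block server placement problem.
-- Block sizes 1..k are encoded by Fin k, where i : Fin k stands for size (toℕ i + 1).
-- f j i is f_j(toℕ i + 1).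
record Instance : Set where
  field
    k     : ℕ
    k-pos : 1 ℕ.≤ k
    n     : ℕ
    d     : Fin n → ℕ
    d-pos : ∀ j → 1 ℕ.≤ d j
    f     : Fin n → Fin k → ℕ
    f-pos : ∀ j i → 1 ℕ.≤ f j i

module _ (I : Instance) where
  open Instance I

  size : Fin k → ℕ
  size i = suc (toℕ i)

  Block : Set
  Block = Fin k × Maybe (Fin n)

  record Machine : Set where
    field
      blocks    : List Block
      partition : sum (map (λ b → size (proj₁ b)) blocks) ≡ k

  servedBlocks : Fin n → List Block → ℕ
  servedBlocks j [] = 0
  servedBlocks j ((i , nothing) ∷ bs) = servedBlocks j bs
  servedBlocks j ((i , just j') ∷ bs) with j ≟ j'
  ... | yes _ = f j i ℕ.+ servedBlocks j bs
  ... | no  _ = servedBlocks j bs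

  served : ∀ {m} → Fin n → Vec Machine m → ℕ
  served j ms = V.sum (V.map (λ M → servedBlocks j (Machine.blocks M)) ms)

  Feasible : ∀ {m} → Vec Machine m → Set
  Feasible ms = ∀ j → d j ℕ.≤ served j ms

  IsOPT : ℕ → Set
  IsOPT m = (Σ (Vec Machine m) Feasible)
          × (∀ m' (ms : Vec Machine m') → Feasible ms → m ℕ.≤ m')

  fhat : Fin n → Fin k → ℕ
  fhat j i = f j i ⊓ d j

  fhat-nonZero : ∀ j i → NonZero (fhat j i)
  fhat-nonZero j i = >-nonZero (⊓-glb (f-pos j i) (d-pos j))

  -- a is α_j: the smallest size maximizing fhat_j(i)/i (ratios compared by cross-multiplication)
  IsAlpha : Fin n → Fin k → Set
  IsAlpha j a =
      (∀ i → fhat j i ℕ.* size a ℕ.≤ fhat j a ℕ.* size i)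
    × (∀ i → toℕ i ℕ.< toℕ a → fhat j i ℕ.* size a ℕ.< fhat j a ℕ.* size i)

  term : (α : Fin n → Fin k) → Fin n → ℚ
  term α j = ((+ (size (α j) ℕ.* d j)) / fhat j (α j)) {{fhat-nonZero j (α j)}}

  lowerBound : (α : Fin n → Fin k) → ℚ
  lowerBound α = ((+ 1) / k) {{>-nonZero k-pos}} ℚ.* sumℚ n (term α)
    where
    sumℚ : (m : ℕ) → (Fin m → ℚ) → ℚ
    sumℚ zero g = 0ℚ
    sumℚ (suc m) g = g Fin.zero ℚ.+ sumℚ m (λ x → g (Fin.suc x))

{-# OPTIONS --safe #-}

-- Fix an optimal solution and let w_j be the number of processors in blocks assigned to job j.
-- Since min(d, a + b) ≤ min(d, a) + min(d, b), capping every block's contribution at d_j keeps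
-- job j covered, so d_j ≤ Σ fhat_j(i) over its blocks; as fhat_j(i)/i ≤ fhat_j(α_j)/α_j, this is
-- at most fhat_j(α_j) w_j / α_j. Thus α_j d_j / fhat_j(α_j) ≤ w_j, and Σ_j w_j ≤ k · OPT.

module Submission where

open import Defs
open import Data.Nat using (ℕ)
open import Data.Fin using (Fin)
open import Data.Integer using (+_)
open import Data.Rational using (_≤_; _/_)

open import Data.Nat as ℕ
  using (zero; suc; _+_; _*_; _⊓_; NonZero; >-nonZero; z≤n)
open import Data.Nat.Properties as ℕ
  using (≤-refl; ≤-reflexive; ≤-trans; ≤-total; +-mono-≤; *-monoˡ-≤; m≤m+n; m≤n+m;
         m⊓n≤m; m⊓n≤n; ⊓-comm; ⊓-monoˡ-≤; m≤n⇒m⊓n≡m; m≥n⇒m⊓n≡n; +-distribˡ-⊓;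
         *-comm; *-distribʳ-+; *-distribˡ-+; +-identityʳ)
open import Data.Nat.ListAction using (sum)
open import Data.Nat.ListAction.Properties using (sum-++)
open import Data.Integer as ℤ using ()
import Data.Integer.Properties as ℤ
open import Data.Integer.Tactic.RingSolver using (solve-∀)
open import Data.Rational as ℚ using (ℚ; toℚᵘ)
open import Data.Rational.Properties as ℚ
  using (toℚᵘ-fromℚᵘ; toℚᵘ-cancel-≤; toℚᵘ-injective; toℚᵘ-homo-+; toℚᵘ-homo-*;
         normalize-nonNeg; *-monoˡ-≤-nonNeg)
open import Data.Rational.Unnormalised as ℚᵘ using (mkℚᵘ; _≃_; *≤*; *≡*)
import Data.Rational.Unnormalised.Properties as ℚᵘ
open import Data.Fin using (_≟_; punchIn)
open import Data.Fin.Properties using (punchInᵢ≢i)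
open import Data.List using (List; []; _∷_; _++_; map)
open import Data.List.Properties using (map-++)
open import Data.Maybe using (just; nothing)
open import Data.Product using (_,_; proj₁)
open import Data.Sum using (inj₁; inj₂)
open import Data.Vec using (Vec; []; _∷_)
open import Data.Empty using (⊥-elim)
open import Function using (_∘_)
open import Relation.Nullary using (yes; no)
open import Relation.Binary.PropositionalEquality
  using (_≡_; _≢_; refl; sym; trans; cong; cong₂; subst; subst₂; module ≡-Reasoning)
open import Algebra.Properties.Semiring.Sum ℕ.+-*-semiring
  using (sum-syntax; sum-remove; sum-cong-≗; sum-replicate-zero; ∑-distrib-+)
import Algebra.Properties.Monoid.Sum ℚ.+-0-monoid as ℚ∑

private
  variable
    A : Set

sum-map-++ : ∀ (g : A → ℕ) xs ys → sum (map g (xs ++ ys)) ≡ sum (map g xs) + sum (map g ys)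
sum-map-++ g xs ys = trans (cong sum (map-++ g xs ys)) (sum-++ (map g xs) (map g ys))

sum-map-mono-≤ : ∀ {g h : A → ℕ} → (∀ x → g x ℕ.≤ h x) → ∀ xs → sum (map g xs) ℕ.≤ sum (map h xs)
sum-map-mono-≤ g≤h []       = z≤n
sum-map-mono-≤ g≤h (x ∷ xs) = +-mono-≤ (g≤h x) (sum-map-mono-≤ g≤h xs)

m⊓[n+o]≤m⊓n+m⊓o : ∀ m n o → m ⊓ (n + o) ℕ.≤ m ⊓ n + m ⊓ o
m⊓[n+o]≤m⊓n+m⊓o m n o with ≤-total m n
... | inj₁ m≤n = begin
  m ⊓ (n + o)      ≤⟨ m⊓n≤m m (n + o) ⟩
  m                ≡⟨ m≤n⇒m⊓n≡m m≤n ⟨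
  m ⊓ n            ≤⟨ m≤m+n (m ⊓ n) (m ⊓ o) ⟩
  m ⊓ n + m ⊓ o    ∎
  where open ℕ.≤-Reasoning
... | inj₂ n≤m = begin
  m ⊓ (n + o)        ≤⟨ ⊓-monoˡ-≤ (n + o) (m≤n+m m n) ⟩
  (n + m) ⊓ (n + o)  ≡⟨ +-distribˡ-⊓ n m o ⟨
  n + m ⊓ o          ≡⟨ cong (_+ m ⊓ o) (m≥n⇒m⊓n≡n n≤m) ⟨
  m ⊓ n + m ⊓ o      ∎
  where open ℕ.≤-Reasoning

⊓-sum-≤ : ∀ c (g : A → ℕ) xs → c ⊓ sum (map g xs) ℕ.≤ sum (map (λ x → c ⊓ g x) xs)
⊓-sum-≤ c g []       = m⊓n≤n c 0
⊓-sum-≤ c g (x ∷ xs) =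
  ≤-trans (m⊓[n+o]≤m⊓n+m⊓o c (g x) _) (+-mono-≤ ≤-refl (⊓-sum-≤ c g xs))

sum-map-*-≤ : ∀ {g h : A → ℕ} {c} e → (∀ x → g x * c ℕ.≤ e * h x) →
              ∀ xs → sum (map g xs) * c ℕ.≤ e * sum (map h xs)
sum-map-*-≤ e gc≤eh []       = z≤n
sum-map-*-≤ {g = g} {h} {c} e gc≤eh (x ∷ xs) = begin
  (g x + sum (map g xs)) * c        ≡⟨ *-distribʳ-+ c (g x) _ ⟩
  g x * c + sum (map g xs) * c      ≤⟨ +-mono-≤ (gc≤eh x) (sum-map-*-≤ e gc≤eh xs) ⟩
  e * h x + e * sum (map h xs)      ≡⟨ *-distribˡ-+ e (h x) _ ⟨
  e * (h x + sum (map h xs))        ∎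
  where open ℕ.≤-Reasoning

∑-vanishing-off : ∀ {n} (t : Fin n → ℕ) i → (∀ j → j ≢ i → t j ≡ 0) → ∑[ j < n ] t j ≡ t i
∑-vanishing-off {suc n} t i t-vanishes = begin
  ∑[ j < suc n ] t j               ≡⟨ sum-remove {i = i} t ⟩
  t i + ∑[ j < n ] t (punchIn i j) ≡⟨ cong (λ s → t i + s)
                                        (sum-cong-≗ (λ j → t-vanishes _ (punchInᵢ≢i i j))) ⟩
  t i + ∑[ j < n ] 0               ≡⟨ cong (λ s → t i + s) (sum-replicate-zero n) ⟩
  t i + 0                          ≡⟨ +-identityʳ (t i) ⟩
  t i                              ∎
  where open ≡-Reasoning

toℚᵘ-/ : ∀ i n .{{_ : NonZero n}} → toℚᵘ (i / n) ≃ mkℚᵘ i (ℕ.pred n)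
toℚᵘ-/ i (suc n) = toℚᵘ-fromℚᵘ (mkℚᵘ i n)

pos-*-mono-≤ : ∀ a b c d → a * b ℕ.≤ c * d → + a ℤ.* + b ℤ.≤ + c ℤ.* + d
pos-*-mono-≤ a b c d ab≤cd = subst₂ ℤ._≤_ (ℤ.pos-* a b) (ℤ.pos-* c d) (ℤ.+≤+ ab≤cd)

m≤n*o⇒m/n≤o/1 : ∀ {m} n {o} .{{_ : NonZero n}} → m ℕ.≤ n * o → (+ m) / n ≤ (+ o) / 1
m≤n*o⇒m/n≤o/1 {m} n@(suc n-1) {o} m≤n*o = toℚᵘ-cancel-≤ (begin
  toℚᵘ ((+ m) / n)  ≃⟨ toℚᵘ-/ (+ m) n ⟩
  mkℚᵘ (+ m) n-1    ≤⟨ *≤* (pos-*-mono-≤ m 1 o n m*1≤o*n) ⟩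
  mkℚᵘ (+ o) 0      ≃⟨ toℚᵘ-/ (+ o) 1 ⟨
  toℚᵘ ((+ o) / 1)  ∎)
  where
  open ℚᵘ.≤-Reasoning
  m*1≤o*n : m * 1 ℕ.≤ o * n
  m*1≤o*n = subst₂ ℕ._≤_ (sym (ℕ.*-identityʳ m)) (*-comm n o) m≤n*o

/1-homo-+ : ∀ m n → (+ m) / 1 ℚ.+ (+ n) / 1 ≡ (+ (m + n)) / 1
/1-homo-+ m n = toℚᵘ-injective (begin
  toℚᵘ ((+ m) / 1 ℚ.+ (+ n) / 1)            ≈⟨ toℚᵘ-homo-+ ((+ m) / 1) ((+ n) / 1) ⟩
  toℚᵘ ((+ m) / 1) ℚᵘ.+ toℚᵘ ((+ n) / 1)    ≈⟨ ℚᵘ.+-cong (toℚᵘ-/ (+ m) 1) (toℚᵘ-/ (+ n) 1) ⟩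
  mkℚᵘ (+ m) 0 ℚᵘ.+ mkℚᵘ (+ n) 0            ≈⟨ *≡* (trans (unit-denominators (+ m) (+ n))
                                                          (cong (ℤ._* + 1) (sym (ℤ.pos-+ m n)))) ⟩
  mkℚᵘ (+ (m + n)) 0                        ≈⟨ toℚᵘ-/ (+ (m + n)) 1 ⟨
  toℚᵘ ((+ (m + n)) / 1)                    ∎)
  where
  open ℚᵘ.≃-Reasoning
  unit-denominators : ∀ i j → (i ℤ.* + 1 ℤ.+ j ℤ.* + 1) ℤ.* + 1 ≡ (i ℤ.+ j) ℤ.* + 1
  unit-denominators = solve-∀

1/n*m/1≤o/1 : ∀ n {m o} .{{_ : NonZero n}} → m ℕ.≤ o * n → (+ 1) / n ℚ.* ((+ m) / 1) ≤ (+ o) / 1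
1/n*m/1≤o/1 n@(suc n-1) {m} {o} m≤o*n = toℚᵘ-cancel-≤ (begin
  toℚᵘ ((+ 1) / n ℚ.* ((+ m) / 1))          ≃⟨ toℚᵘ-homo-* ((+ 1) / n) ((+ m) / 1) ⟩
  toℚᵘ ((+ 1) / n) ℚᵘ.* toℚᵘ ((+ m) / 1)    ≃⟨ ℚᵘ.*-cong (toℚᵘ-/ (+ 1) n) (toℚᵘ-/ (+ m) 1) ⟩
  mkℚᵘ (+ 1) n-1 ℚᵘ.* mkℚᵘ (+ m) 0          ≤⟨ *≤* cross-multiplied ⟩
  mkℚᵘ (+ o) 0                              ≃⟨ toℚᵘ-/ (+ o) 1 ⟨
  toℚᵘ ((+ o) / 1)                          ∎)
  where
  open ℚᵘ.≤-Reasoning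
  cross-multiplied : (+ 1 ℤ.* + m) ℤ.* + 1 ℤ.≤ + o ℤ.* + (n * 1)
  cross-multiplied = subst (λ i → i ℤ.* + 1 ℤ.≤ + o ℤ.* + (n * 1)) (sym (ℤ.*-identityˡ (+ m)))
    (pos-*-mono-≤ m 1 o (n * 1)
      (subst₂ ℕ._≤_ (sym (ℕ.*-identityʳ m)) (cong (o *_) (sym (ℕ.*-identityʳ n))) m≤o*n))

∑-≤-/1 : ∀ {m} (g : Fin m → ℚ) (w : Fin m → ℕ) → (∀ i → g i ≤ (+ w i) / 1) →
         ℚ∑.sum g ≤ (+ (∑[ i < m ] w i)) / 1
∑-≤-/1 {zero}  g w g≤w = ℚ.≤-refl
∑-≤-/1 {suc m} g w g≤w = subst (ℚ∑.sum g ≤_) (/1-homo-+ (w Fin.zero) _)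
  (ℚ.+-mono-≤ (g≤w Fin.zero) (∑-≤-/1 (g ∘ Fin.suc) (w ∘ Fin.suc) (g≤w ∘ Fin.suc)))

module _ (I : Instance) where
  open Instance I

  forJob : Fin n → (Fin k → ℕ) → Block I → ℕ
  forJob j g (i , nothing) = 0
  forJob j g (i , just j′) with j ≟ j′
  ... | yes _ = g i
  ... | no  _ = 0

  servedBlocks≡sum-forJob : ∀ j bs → servedBlocks I j bs ≡ sum (map (forJob j (f j)) bs)
  servedBlocks≡sum-forJob j []                   = refl
  servedBlocks≡sum-forJob j ((i , nothing) ∷ bs) = servedBlocks≡sum-forJob j bs
  servedBlocks≡sum-forJob j ((i , just j′) ∷ bs) with j ≟ j′
  ... | yes _ = cong (λ s → f j i + s) (servedBlocks≡sum-forJob j bs)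
  ... | no  _ = servedBlocks≡sum-forJob j bs

  forJob-⊓-≤ : ∀ c j g b → c ⊓ forJob j g b ℕ.≤ forJob j (λ i → g i ⊓ c) b
  forJob-⊓-≤ c j g (i , nothing) = m⊓n≤n c 0
  forJob-⊓-≤ c j g (i , just j′) with j ≟ j′
  ... | yes _ = ≤-reflexive (⊓-comm c (g i))
  ... | no  _ = m⊓n≤n c 0

  forJob-*-≤ : ∀ {j g h c} e → (∀ i → g i * c ℕ.≤ e * h i) →
               ∀ b → forJob j g b * c ℕ.≤ e * forJob j h b
  forJob-*-≤         e gc≤eh (i , nothing) = z≤n
  forJob-*-≤ {j = j} e gc≤eh (i , just j′) with j ≟ j′
  ... | yes _ = gc≤eh i
  ... | no  _ = z≤n

  ∑-forJob-≤ : ∀ g b → ∑[ j < n ] forJob j g b ℕ.≤ g (proj₁ b)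
  ∑-forJob-≤ g (i , nothing) = ≤-trans (≤-reflexive (sum-replicate-zero n)) z≤n
  ∑-forJob-≤ g (i , just j′) = ≤-reflexive (trans (∑-vanishing-off _ j′ forJob-off) forJob-self)
    where
    forJob-off : ∀ j → j ≢ j′ → forJob j g (i , just j′) ≡ 0
    forJob-off j j≢j′ with j ≟ j′
    ... | yes j≡j′ = ⊥-elim (j≢j′ j≡j′)
    ... | no  _    = refl
    forJob-self : forJob j′ g (i , just j′) ≡ g i
    forJob-self with j′ ≟ j′
    ... | yes _     = refl
    ... | no  j′≢j′ = ⊥-elim (j′≢j′ refl)

  ∑-sum-forJob-≤ : ∀ g bs → ∑[ j < n ] sum (map (forJob j g) bs) ℕ.≤ sum (map (g ∘ proj₁) bs)
  ∑-sum-forJob-≤ g []       = ≤-reflexive (sum-replicate-zero n)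
  ∑-sum-forJob-≤ g (b ∷ bs) = begin
    ∑[ j < n ] (forJob j g b + sum (map (forJob j g) bs))
      ≡⟨ ∑-distrib-+ (λ j → forJob j g b) (λ j → sum (map (forJob j g) bs)) ⟩
    ∑[ j < n ] forJob j g b + ∑[ j < n ] sum (map (forJob j g) bs)
      ≤⟨ +-mono-≤ (∑-forJob-≤ g b) (∑-sum-forJob-≤ g bs) ⟩
    g (proj₁ b) + sum (map (g ∘ proj₁) bs)
      ∎
    where open ℕ.≤-Reasoning

  size*d≤fhat*assignedSize : ∀ j a bs → (∀ i → fhat I j i * size I a ℕ.≤ fhat I j a * size I i) →
                             d j ℕ.≤ sum (map (forJob j (f j)) bs) →
                             size I a * d j ℕ.≤ fhat I j a * sum (map (forJob j (size I)) bs)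
  size*d≤fhat*assignedSize j a bs ratio-maximal covered = begin
    size I a * d j                                 ≡⟨ *-comm (size I a) (d j) ⟩
    d j * size I a                                 ≤⟨ *-monoˡ-≤ (size I a) capped-covered ⟩
    sum (map (forJob j (fhat I j)) bs) * size I a  ≤⟨ sum-map-*-≤ (fhat I j a)
                                                        (forJob-*-≤ (fhat I j a) ratio-maximal) bs ⟩
    fhat I j a * sum (map (forJob j (size I)) bs)  ∎
    where
    open ℕ.≤-Reasoning
    capped-covered : d j ℕ.≤ sum (map (forJob j (fhat I j)) bs)
    capped-covered = begin
      d j                                          ≡⟨ m≤n⇒m⊓n≡m covered ⟨
      d j ⊓ sum (map (forJob j (f j)) bs)          ≤⟨ ⊓-sum-≤ (d j) (forJob j (f j)) bs ⟩
      sum (map (λ b → d j ⊓ forJob j (f j) b) bs)  ≤⟨ sum-map-mono-≤ (forJob-⊓-≤ (d j) j (f j)) bs ⟩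
      sum (map (forJob j (fhat I j)) bs)           ∎

  blocksOf : ∀ {m} → Vec (Machine I) m → List (Block I)
  blocksOf []       = []
  blocksOf (M ∷ ms) = Machine.blocks M ++ blocksOf ms

  served≡sum-forJob : ∀ {m} j (ms : Vec (Machine I) m) →
                      served I j ms ≡ sum (map (forJob j (f j)) (blocksOf ms))
  served≡sum-forJob j []       = refl
  served≡sum-forJob j (M ∷ ms) = begin
    servedBlocks I j (blocks M) + served I j ms
      ≡⟨ cong₂ _+_ (servedBlocks≡sum-forJob j (blocks M)) (served≡sum-forJob j ms) ⟩
    sum (map (forJob j (f j)) (blocks M)) + sum (map (forJob j (f j)) (blocksOf ms))
      ≡⟨ sum-map-++ (forJob j (f j)) (blocks M) (blocksOf ms) ⟨
    sum (map (forJob j (f j)) (blocks M ++ blocksOf ms))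
      ∎
    where
    open ≡-Reasoning
    open Machine

  sum-size-blocksOf : ∀ {m} (ms : Vec (Machine I) m) →
                      sum (map (size I ∘ proj₁) (blocksOf ms)) ≡ m * k
  sum-size-blocksOf []       = refl
  sum-size-blocksOf (M ∷ ms) = trans (sum-map-++ (size I ∘ proj₁) (Machine.blocks M) (blocksOf ms))
                                     (cong₂ _+_ (Machine.partition M) (sum-size-blocksOf ms))

  private instance
    k≢0 : NonZero k
    k≢0 = >-nonZero k-pos

  private
    mutual
      -- `lowerBound` sums with a function local to its where-block, which cannot be named;
      -- this meta is solved to it by unification once `with` abstracts n and the summand.
      localSum : (Fin n → Fin k) → (m : ℕ) → (Fin m → ℚ) → ℚ
      localSum = _

      lowerBound≡localSum : ∀ α → lowerBound I α ≡ (+ 1) / k ℚ.* localSum α n (term I α)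
      lowerBound≡localSum α with n | term I α
      ... | _ | _ = refl

    localSum≡∑ : ∀ α m g → localSum α m g ≡ ℚ∑.sum g
    localSum≡∑ α zero    g = refl
    localSum≡∑ α (suc m) g = cong (g Fin.zero ℚ.+_) (localSum≡∑ α m (g ∘ Fin.suc))

  lowerBound≡ : ∀ α → lowerBound I α ≡ (+ 1) / k ℚ.* ℚ∑.sum (term I α)
  lowerBound≡ α =
    trans (lowerBound≡localSum α) (cong ((+ 1) / k ℚ.*_) (localSum≡∑ α n (term I α)))

mainTheorem6 : (I : Instance) (α : Fin (Instance.n I) → Fin (Instance.k I))
    → (∀ j → IsAlpha I j (α j))
    → (opt : ℕ) → IsOPT I opt
    → lowerBound I α ≤ (+ opt) / 1
mainTheorem6 I α isα opt ((ms , feasible) , _) = begin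
  lowerBound I α                           ≡⟨ lowerBound≡ I α ⟩
  (+ 1) / k ℚ.* ℚ∑.sum (term I α)          ≤⟨ *-monoˡ-≤-nonNeg ((+ 1) / k) (∑-≤-/1 (term I α) w term≤w) ⟩
  (+ 1) / k ℚ.* ((+ ∑[ j < n ] w j) / 1)   ≤⟨ 1/n*m/1≤o/1 k {o = opt} total≤opt*k ⟩
  (+ opt) / 1                              ∎
  where
  open Instance I
  open ℚ.≤-Reasoning
  instance
    k≢0 : NonZero k
    k≢0 = >-nonZero k-pos
    1/k≥0 : ℚ.NonNegative ((+ 1) / k)
    1/k≥0 = normalize-nonNeg 1 k

  w : Fin n → ℕ
  w j = sum (map (forJob I j (size I)) (blocksOf I ms))

  term≤w : ∀ j → term I α j ≤ (+ w j) / 1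
  term≤w j = m≤n*o⇒m/n≤o/1 (fhat I j (α j)) {{fhat-nonZero I j (α j)}}
    (size*d≤fhat*assignedSize I j (α j) (blocksOf I ms) (proj₁ (isα j))
      (subst (d j ℕ.≤_) (served≡sum-forJob I j ms) (feasible j)))

  total≤opt*k : ∑[ j < n ] w j ℕ.≤ opt * k
  total≤opt*k = ≤-trans (∑-sum-forJob-≤ I (size I) (blocksOf I ms))
                        (≤-reflexive (sum-size-blocksOf I ms))
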